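{- For integers $n\geq 1$ define \[ V_{n}(x):=\frac{2(n+1)}{\binom{2n}{n}x^{n}(1-2x)}\left(Q_{n}(-x)^2-Q_{n-1}(-x)Q_{n+1}(-x)\right). \] Then $V_1(x)=2$, $V_2(x)=2x+3$, and for all $n\geq 3$, \[ n(x-1)V_{n}(x)=\big(2(2n-3)x(x-1)-n-1\big)V_{n-1}(x)+2(2n-1)xV_{n-2}(x). \]
   Context: For each integer $m\geq 0$, $P_m(x),Q_m(x)\in\mathbb{Q}[x]$ denote the unique pair of polynomials with $\deg P_m\leq m$, $\deg Q_m\leq m$ satisfying $P_m(x)x^{m+1}+Q_m(x)(x+1)^{m+1}=1$. -}

module Defs where

open import Data.Nat as ℕ using (ℕ; zero; suc; _≤_; z≤n; s≤s)
open import Data.Nat.Properties as ℕP using (m+n≡0⇒m≡0)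
open import Data.Nat.Combinatorics using (_C_; nCn≡1; nCk≡nC[n∸k]; nCk+nC[k+1]≡[n+1]C[k+1])
open import Data.Integer using (+_)
open import Data.Rational using (ℚ; 0ℚ; 1ℚ; _+_; _*_; _-_; -_; _/_; _÷_; NonZero; ≢-nonZero; 1/_)
open import Data.Rational.Properties using (*-assoc; *-identityʳ; *-zeroˡ; *-inverseʳ)
open import Data.Vec using (Vec; []; _∷_)
open import Relation.Binary.PropositionalEquality using (_≡_; _≢_; refl; sym; trans; cong)

ℕtoℚ : ℕ → ℚ
ℕtoℚ n = (+ n) / 1

infixr 8 _^_
_^_ : ℚ → ℕ → ℚ
x ^ zero  = 1ℚ
x ^ suc n = x * (x ^ n)

-- A polynomial of degree ≤ m over ℚ is given by its m+1 coefficients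
-- (c₀ , c₁ , … , c_m), representing c₀ + c₁ x + … + c_m x^m.
Poly≤ : ℕ → Set
Poly≤ m = Vec ℚ (suc m)

eval : ∀ {k} → Vec ℚ k → ℚ → ℚ
eval []       x = 0ℚ
eval (c ∷ cs) x = c + x * eval cs x

-- (P_m, Q_m) is, for every m, a pair of polynomials of degree ≤ m with
-- P_m(x) x^(m+1) + Q_m(x) (x+1)^(m+1) = 1 as an identity in ℚ[x]
-- (stated as equality of the polynomial functions on the infinite field ℚ).
IsBezoutFamily : ((m : ℕ) → Poly≤ m) → ((m : ℕ) → Poly≤ m) → Set
IsBezoutFamily P Q = ∀ (m : ℕ) (x : ℚ) →
  eval (P m) x * x ^ suc m + eval (Q m) x * (x + 1ℚ) ^ suc m ≡ 1ℚ

1≢0 : 1 ≢ 0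
1≢0 ()

C≢0 : ∀ n k → k ≤ n → n C k ≢ 0
C≢0 n zero _ eq = 1≢0 (trans (sym (nCn≡1 n)) (trans (sym (nCk≡nC[n∸k] (z≤n {n}))) eq))
C≢0 (suc n) (suc k) (s≤s k≤n) eq =
  C≢0 n k k≤n (m+n≡0⇒m≡0 (n C k) (trans (nCk+nC[k+1]≡[n+1]C[k+1] n k) eq))

*-≢0 : ∀ {p q : ℚ} → p ≢ 0ℚ → q ≢ 0ℚ → p * q ≢ 0ℚ
*-≢0 {p} {q} p≢0 q≢0 pq≡0 = p≢0 (trans (sym (trans (*-assoc p q (1/ q)) (trans (cong (p *_) (*-inverseʳ q)) (*-identityʳ p))))
                                (trans (cong (_* (1/ q)) pq≡0) (*-zeroˡ (1/ q))))
  where instance _ = ≢-nonZero q≢0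

^-≢0 : ∀ {x : ℚ} n → x ≢ 0ℚ → x ^ n ≢ 0ℚ
^-≢0 zero    x≢0 ()
^-≢0 (suc n) x≢0 = *-≢0 x≢0 (^-≢0 n x≢0)

two : ℚ
two = ℕtoℚ 2

-- V_n(x) := 2(n+1) / (binom(2n,n) x^n (1-2x)) · (Q_n(-x)² − Q_{n-1}(-x) Q_{n+1}(-x)),
-- for n ≥ 1 and x with x ≠ 0, 1 − 2x ≠ 0 (V_0 is not defined in the paper; junk value 0).
V : ((m : ℕ) → Poly≤ m) → ℕ → (x : ℚ) → x ≢ 0ℚ → 1ℚ - two * x ≢ 0ℚ → ℚ
V Q zero    x x≢0 h = 0ℚ
V Q (suc k) x x≢0 h =
  _÷_ (((+ (2 ℕ.* (n ℕ.+ 1)) / ((2 ℕ.* n) C n)) {{ℕ.≢-nonZero binom≢0}})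
        * (eval (Q n) (- x) * eval (Q n) (- x) - eval (Q k) (- x) * eval (Q (suc n)) (- x)))
      (x ^ n * (1ℚ - two * x))
      {{≢-nonZero (*-≢0 (^-≢0 n x≢0) h)}}
  where
    n = suc k
    binom≢0 : (2 ℕ.* n) C n ≢ 0
    binom≢0 = C≢0 (2 ℕ.* n) n (ℕP.m≤m+n n (n ℕ.+ 0))

-- Replacing x by -x, the Bézout identity says (1 - x)^(m+1) Q_m(-x) ≡ 1 modulo x^(m+1);
-- as deg Q_m ≤ m this forces Q_m(-x) = q_m(x) := Σ_{k ≤ m} C(m+k, k) x^k, the truncation of
-- (1 - x)^(-(m+1)). Telescoping gives 2(1 - x) q_n = 2 q_(n-1) + C(2n, n) x^n (1 - 2x). Using it twice
-- in the Turán expression q_n² - q_(n-1) q_(n+1) cancels the factor x^n (1 - 2x) / C(2n, n) of V_n: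
-- (1 - x) V_n = (n + 1) q_n - 2(2n + 1) x q_(n-1). Eliminating C(2n, n) x^n (1 - 2x) between two
-- consecutive steps gives a three-term recurrence for q_n, of which the recurrence for V_n is a linear
-- combination. At x = 1 the closed form says nothing about V_n; there q_n(1) = C(2n+2, n+1) / 2 gives
-- (n + 2) V_n(1) = C(2n+2, n+1) directly.

module Submission where

import Data.Nat as ℕ
open import Data.Nat using (ℕ; zero; suc; _∸_; _≤_; s≤s; z≤n)
import Data.Nat.Properties as ℕₚ
open import Data.Nat.Combinatorics using (_C_; nCk+nC[k+1]≡[n+1]C[k+1]; nCk≡nC[n∸k]; k>n⇒nCk≡0; nC1≡n)
import Data.Nat.Tactic.RingSolver as ℕ-Solver
import Data.Integer as ℤ
import Data.Integer.Properties as ℤₚ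
import Data.Integer.Tactic.RingSolver as ℤ-Solver
open import Data.Rational using (ℚ; 0ℚ; 1ℚ; _+_; _*_; _-_; -_; _/_; _÷_; 1/_; NonZero; ≢-nonZero; fromℚᵘ; toℚᵘ)
import Data.Rational.Properties as ℚₚ
open import Data.Rational.Unnormalised as ℚᵘ using (mkℚᵘ; *≡*)
import Data.Rational.Unnormalised.Properties as ℚᵘₚ
import Data.List as List
open import Data.List using (List; []; _∷_)
open import Data.Product using (∃-syntax; _×_; _,_; proj₁; proj₂)
open import Data.Maybe using (Maybe; just; nothing)
open import Function using (_∘_)
open import Relation.Nullary using (Dec; yes; no)
open import Relation.Binary.PropositionalEquality
import Tactic.RingSolver.Core.AlmostCommutativeRing as ACR
open import Tactic.RingSolver using (solve-∀; solve)

open import Defs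

ℚ-ring : ACR.AlmostCommutativeRing _ _
ℚ-ring = ACR.fromCommutativeRing ℚₚ.+-*-commutativeRing isZero
  where
  isZero : ∀ x → Maybe (0ℚ ≡ x)
  isZero x with 0ℚ ℚₚ.≟ x
  ... | yes 0≡x = just 0≡x
  ... | no _    = nothing

two≢0 : two ≢ 0ℚ
two≢0 ()

*-cancelˡ-≢0 : ∀ {a u v} → a ≢ 0ℚ → a * u ≡ a * v → u ≡ v
*-cancelˡ-≢0 {a} {u} {v} a≢0 au≡av = begin
  u                ≡⟨ sym (ℚₚ.*-identityˡ u) ⟩
  1ℚ * u           ≡⟨ cong (_* u) (sym (ℚₚ.*-inverseˡ a)) ⟩
  (1/ a) * a * u   ≡⟨ ℚₚ.*-assoc (1/ a) a u ⟩
  (1/ a) * (a * u) ≡⟨ cong ((1/ a) *_) au≡av ⟩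
  (1/ a) * (a * v) ≡⟨ sym (ℚₚ.*-assoc (1/ a) a v) ⟩
  (1/ a) * a * v   ≡⟨ cong (_* v) (ℚₚ.*-inverseˡ a) ⟩
  1ℚ * v           ≡⟨ ℚₚ.*-identityˡ v ⟩
  v                ∎
  where
  open ≡-Reasoning
  instance _ = ≢-nonZero a≢0

*≡0⇒≡0 : ∀ {a b} → a ≢ 0ℚ → a * b ≡ 0ℚ → b ≡ 0ℚ
*≡0⇒≡0 {a} a≢0 ab≡0 = *-cancelˡ-≢0 a≢0 (trans ab≡0 (sym (ℚₚ.*-zeroʳ a)))

p-q≡0⇒p≡q : ∀ {p q} → p - q ≡ 0ℚ → p ≡ q
p-q≡0⇒p≡q {p} {q} p-q≡0 = begin
  p             ≡⟨ solve (p ∷ q ∷ []) ℚ-ring ⟩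
  (p - q) + q   ≡⟨ cong (_+ q) p-q≡0 ⟩
  0ℚ + q        ≡⟨ ℚₚ.+-identityˡ q ⟩
  q             ∎
  where open ≡-Reasoning

linear-combination₂ : ∀ {u v a b c d} l m → a ≡ b → c ≡ d → u - v ≡ l * (a - b) + m * (c - d) → u ≡ v
linear-combination₂ {u} {v} {a} {c = c} l m refl refl eq = p-q≡0⇒p≡q (begin
  u - v                        ≡⟨ eq ⟩
  l * (a - a) + m * (c - c)    ≡⟨ solve (l ∷ m ∷ a ∷ c ∷ []) ℚ-ring ⟩
  0ℚ                           ∎)
  where open ≡-Reasoning

÷-*-cancel : ∀ p q .{{_ : NonZero q}} → (p ÷ q) * q ≡ p
÷-*-cancel p q = begin
  p * (1/ q) * q   ≡⟨ ℚₚ.*-assoc p (1/ q) q ⟩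
  p * ((1/ q) * q) ≡⟨ cong (p *_) (ℚₚ.*-inverseˡ q) ⟩
  p * 1ℚ           ≡⟨ ℚₚ.*-identityʳ p ⟩
  p                ∎
  where open ≡-Reasoning

1^n≡1 : ∀ n → 1ℚ ^ n ≡ 1ℚ
1^n≡1 zero    = refl
1^n≡1 (suc n) = trans (ℚₚ.*-identityˡ _) (1^n≡1 n)

^-distribʳ-* : ∀ a b n → (a * b) ^ n ≡ a ^ n * b ^ n
^-distribʳ-* a b zero    = refl
^-distribʳ-* a b (suc n) = trans (cong (a * b *_) (^-distribʳ-* a b n)) (reshuffle a b (a ^ n) (b ^ n))
  where
  reshuffle : ∀ a b c d → a * b * (c * d) ≡ a * c * (b * d)
  reshuffle = solve-∀ ℚ-ring

fromℚᵘ-homo-+ : ∀ p q → fromℚᵘ (p ℚᵘ.+ q) ≡ fromℚᵘ p + fromℚᵘ q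
fromℚᵘ-homo-+ p q = ℚₚ.toℚᵘ-injective (begin
  toℚᵘ (fromℚᵘ (p ℚᵘ.+ q))                ≈⟨ ℚₚ.toℚᵘ-fromℚᵘ (p ℚᵘ.+ q) ⟩
  p ℚᵘ.+ q                                ≈⟨ ℚᵘₚ.+-cong (ℚᵘₚ.≃-sym (ℚₚ.toℚᵘ-fromℚᵘ p)) (ℚᵘₚ.≃-sym (ℚₚ.toℚᵘ-fromℚᵘ q)) ⟩
  toℚᵘ (fromℚᵘ p) ℚᵘ.+ toℚᵘ (fromℚᵘ q)    ≈⟨ ℚᵘₚ.≃-sym (ℚₚ.toℚᵘ-homo-+ (fromℚᵘ p) (fromℚᵘ q)) ⟩
  toℚᵘ (fromℚᵘ p + fromℚᵘ q)              ∎)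
  where open ℚᵘₚ.≃-Reasoning

fromℚᵘ-homo-* : ∀ p q → fromℚᵘ (p ℚᵘ.* q) ≡ fromℚᵘ p * fromℚᵘ q
fromℚᵘ-homo-* p q = ℚₚ.toℚᵘ-injective (begin
  toℚᵘ (fromℚᵘ (p ℚᵘ.* q))                ≈⟨ ℚₚ.toℚᵘ-fromℚᵘ (p ℚᵘ.* q) ⟩
  p ℚᵘ.* q                                ≈⟨ ℚᵘₚ.*-cong (ℚᵘₚ.≃-sym (ℚₚ.toℚᵘ-fromℚᵘ p)) (ℚᵘₚ.≃-sym (ℚₚ.toℚᵘ-fromℚᵘ q)) ⟩
  toℚᵘ (fromℚᵘ p) ℚᵘ.* toℚᵘ (fromℚᵘ q)    ≈⟨ ℚᵘₚ.≃-sym (ℚₚ.toℚᵘ-homo-* (fromℚᵘ p) (fromℚᵘ q)) ⟩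
  toℚᵘ (fromℚᵘ p * fromℚᵘ q)              ∎)
  where open ℚᵘₚ.≃-Reasoning

-- ℕtoℚ n is definitionally fromℚᵘ (mkℚᵘ (ℤ.+ n) 0), so it inherits the homomorphism laws of fromℚᵘ.

ℕtoℚ-+ : ∀ m n → ℕtoℚ (m ℕ.+ n) ≡ ℕtoℚ m + ℕtoℚ n
ℕtoℚ-+ m n = trans
  (ℚₚ.fromℚᵘ-cong {mkℚᵘ (ℤ.+ (m ℕ.+ n)) 0} {mkℚᵘ (ℤ.+ m) 0 ℚᵘ.+ mkℚᵘ (ℤ.+ n) 0} (*≡* (cong (ℤ._* ℤ.+ 1) (sum (ℤ.+ m) (ℤ.+ n)))))
  (fromℚᵘ-homo-+ (mkℚᵘ (ℤ.+ m) 0) (mkℚᵘ (ℤ.+ n) 0))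
  where
  sum : ∀ a b → a ℤ.+ b ≡ a ℤ.* ℤ.+ 1 ℤ.+ b ℤ.* ℤ.+ 1
  sum = ℤ-Solver.solve-∀

ℕtoℚ-* : ∀ m n → ℕtoℚ (m ℕ.* n) ≡ ℕtoℚ m * ℕtoℚ n
ℕtoℚ-* m n = trans
  (ℚₚ.fromℚᵘ-cong {mkℚᵘ (ℤ.+ (m ℕ.* n)) 0} {mkℚᵘ (ℤ.+ m) 0 ℚᵘ.* mkℚᵘ (ℤ.+ n) 0} (*≡* (cong (ℤ._* ℤ.+ 1) (ℤₚ.pos-* m n))))
  (fromℚᵘ-homo-* (mkℚᵘ (ℤ.+ m) 0) (mkℚᵘ (ℤ.+ n) 0))

ℕtoℚ-suc : ∀ n → ℕtoℚ (suc n) ≡ ℕtoℚ n + 1ℚ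
ℕtoℚ-suc n = trans (cong ℕtoℚ (ℕₚ.+-comm 1 n)) (ℕtoℚ-+ n 1)

ℕtoℚ-suc≢0 : ∀ n → ℕtoℚ (suc n) ≢ 0ℚ
ℕtoℚ-suc≢0 n eq with subst (λ p → toℚᵘ p ℚᵘ.≃ mkℚᵘ (ℤ.+ suc n) 0) eq (ℚₚ.toℚᵘ-fromℚᵘ (mkℚᵘ (ℤ.+ suc n) 0))
... | *≡* ()

ℕtoℚ-≢0 : ∀ {n} → n ≢ 0 → ℕtoℚ n ≢ 0ℚ
ℕtoℚ-≢0 {zero}  n≢0 = λ _ → n≢0 refl
ℕtoℚ-≢0 {suc n} _   = ℕtoℚ-suc≢0 n

/-*-cancel : ∀ a b .{{_ : ℕ.NonZero b}} → ((ℤ.+ a) / b) * ℕtoℚ b ≡ ℕtoℚ a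
/-*-cancel a (suc b) = trans (sym (fromℚᵘ-homo-* (mkℚᵘ (ℤ.+ a) b) (mkℚᵘ (ℤ.+ suc b) 0)))
  (ℚₚ.fromℚᵘ-cong {mkℚᵘ (ℤ.+ a) b ℚᵘ.* mkℚᵘ (ℤ.+ suc b) 0} {mkℚᵘ (ℤ.+ a) 0} (*≡* (begin
    ℤ.+ a ℤ.* ℤ.+ suc b ℤ.* ℤ.+ 1 ≡⟨ ℤₚ.*-identityʳ _ ⟩
    ℤ.+ a ℤ.* ℤ.+ suc b         ≡⟨ cong (λ d → ℤ.+ a ℤ.* ℤ.+ d) (sym (ℕₚ.*-identityʳ (suc b))) ⟩
    ℤ.+ a ℤ.* ℤ.+ (suc b ℕ.* 1) ∎)))
  where open ≡-Reasoning

module Polynomial where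

  open import Data.Vec as Vec using (Vec; []; _∷_)

  evalList : List ℚ → ℚ → ℚ
  evalList cs = eval (Vec.fromList cs)

  IsPolynomial : (ℚ → ℚ) → Set
  IsPolynomial f = ∃[ cs ] (∀ x → f x ≡ evalList cs x)

  infixl 6 _⊕_
  infixl 7 _⊗_

  _⊕_ : List ℚ → List ℚ → List ℚ
  [] ⊕ ds = ds
  (c ∷ cs) ⊕ [] = c ∷ cs
  (c ∷ cs) ⊕ (d ∷ ds) = (c + d) ∷ (cs ⊕ ds)

  _⊗_ : List ℚ → List ℚ → List ℚ
  [] ⊗ ds = []
  (c ∷ cs) ⊗ ds = List.map (c *_) ds ⊕ (0ℚ ∷ cs ⊗ ds)

  evalList-⊕ : ∀ cs ds x → evalList (cs ⊕ ds) x ≡ evalList cs x + evalList ds x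
  evalList-⊕ []       ds       x = sym (ℚₚ.+-identityˡ _)
  evalList-⊕ (c ∷ cs) []       x = sym (ℚₚ.+-identityʳ _)
  evalList-⊕ (c ∷ cs) (d ∷ ds) x =
    trans (cong (λ s → c + d + x * s) (evalList-⊕ cs ds x)) (reshuffle c d x (evalList cs x) (evalList ds x))
    where
    reshuffle : ∀ c d x s t → c + d + x * (s + t) ≡ (c + x * s) + (d + x * t)
    reshuffle = solve-∀ ℚ-ring

  evalList-scale : ∀ c ds x → evalList (List.map (c *_) ds) x ≡ c * evalList ds x
  evalList-scale c []       x = sym (ℚₚ.*-zeroʳ c)
  evalList-scale c (d ∷ ds) x =
    trans (cong (λ s → c * d + x * s) (evalList-scale c ds x)) (reshuffle c d x (evalList ds x))
    where
    reshuffle : ∀ c d x s → c * d + x * (c * s) ≡ c * (d + x * s)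
    reshuffle = solve-∀ ℚ-ring

  evalList-⊗ : ∀ cs ds x → evalList (cs ⊗ ds) x ≡ evalList cs x * evalList ds x
  evalList-⊗ []       ds x = sym (ℚₚ.*-zeroˡ (evalList ds x))
  evalList-⊗ (c ∷ cs) ds x = begin
    evalList (List.map (c *_) ds ⊕ (0ℚ ∷ cs ⊗ ds)) x              ≡⟨ evalList-⊕ (List.map (c *_) ds) (0ℚ ∷ cs ⊗ ds) x ⟩
    evalList (List.map (c *_) ds) x + (0ℚ + x * evalList (cs ⊗ ds) x) ≡⟨ cong₂ (λ s t → s + (0ℚ + x * t)) (evalList-scale c ds x) (evalList-⊗ cs ds x) ⟩
    c * evalList ds x + (0ℚ + x * (evalList cs x * evalList ds x))    ≡⟨ reshuffle c x (evalList cs x) (evalList ds x) ⟩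
    (c + x * evalList cs x) * evalList ds x                           ∎
    where
    open ≡-Reasoning
    reshuffle : ∀ c x s t → c * t + (0ℚ + x * (s * t)) ≡ (c + x * s) * t
    reshuffle = solve-∀ ℚ-ring

  poly-const : ∀ a → IsPolynomial (λ _ → a)
  poly-const a = a ∷ [] , λ x → sym (trans (cong (a +_) (ℚₚ.*-zeroʳ x)) (ℚₚ.+-identityʳ a))

  poly-id : IsPolynomial (λ x → x)
  poly-id = 0ℚ ∷ 1ℚ ∷ [] , λ x → reshuffle x
    where
    reshuffle : ∀ x → x ≡ 0ℚ + x * (1ℚ + x * 0ℚ)
    reshuffle = solve-∀ ℚ-ring

  poly-+ : ∀ {f g} → IsPolynomial f → IsPolynomial g → IsPolynomial (λ x → f x + g x)
  poly-+ (cs , f≗) (ds , g≗) = cs ⊕ ds , λ x → trans (cong₂ _+_ (f≗ x) (g≗ x)) (sym (evalList-⊕ cs ds x))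

  poly-* : ∀ {f g} → IsPolynomial f → IsPolynomial g → IsPolynomial (λ x → f x * g x)
  poly-* (cs , f≗) (ds , g≗) = cs ⊗ ds , λ x → trans (cong₂ _*_ (f≗ x) (g≗ x)) (sym (evalList-⊗ cs ds x))

  poly-- : ∀ {f g} → IsPolynomial f → IsPolynomial g → IsPolynomial (λ x → f x - g x)
  poly-- {f} {g} pf pg with poly-+ pf (poly-* (poly-const (- 1ℚ)) pg)
  ... | cs , h≗ = cs , λ x → trans (reshuffle (f x) (g x)) (h≗ x)
    where
    reshuffle : ∀ a b → a - b ≡ a + (- 1ℚ) * b
    reshuffle = solve-∀ ℚ-ring

  poly-^ : ∀ {f} → IsPolynomial f → ∀ n → IsPolynomial (λ x → f x ^ n)
  poly-^ pf zero    = poly-const 1ℚ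
  poly-^ pf (suc n) = poly-* pf (poly-^ pf n)

  poly-eval : ∀ {k} (cs : Vec ℚ k) → IsPolynomial (eval cs)
  poly-eval cs = Vec.toList cs , eval≗ cs
    where
    eval≗ : ∀ {k} (cs : Vec ℚ k) x → eval cs x ≡ evalList (Vec.toList cs) x
    eval≗ []       x = refl
    eval≗ (c ∷ cs) x = cong (λ s → c + x * s) (eval≗ cs x)

  quotient : ∀ {k} → ℚ → Vec ℚ (suc k) → Vec ℚ k
  quotient r (c ∷ [])     = []
  quotient r (c ∷ d ∷ cs) = eval (d ∷ cs) r ∷ quotient r (d ∷ cs)

  eval-quotient : ∀ {k} r (cs : Vec ℚ (suc k)) x → eval cs x ≡ eval cs r + (x - r) * eval (quotient r cs) x
  eval-quotient r (c ∷ []) x = reshuffle c r x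
    where
    reshuffle : ∀ c r x → c + x * 0ℚ ≡ (c + r * 0ℚ) + (x - r) * 0ℚ
    reshuffle = solve-∀ ℚ-ring
  eval-quotient r (c ∷ d ∷ cs) x =
    trans (cong (λ s → c + x * s) (eval-quotient r (d ∷ cs) x))
          (reshuffle c x r (eval (d ∷ cs) r) (eval (quotient r (d ∷ cs)) x))
    where
    reshuffle : ∀ c x r s t → c + x * (s + (x - r) * t) ≡ (c + r * s) + (x - r) * (s + x * t)
    reshuffle = solve-∀ ℚ-ring

  eval≡0-from : ∀ {k} (cs : Vec ℚ k) s → (∀ i → eval cs (ℕtoℚ (s ℕ.+ i)) ≡ 0ℚ) → ∀ x → eval cs x ≡ 0ℚ
  eval≡0-from []          s vanish x = refl
  eval≡0-from cs@(_ ∷ _) s vanish x = begin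
    eval cs x                                    ≡⟨ eval-quotient r cs x ⟩
    eval cs r + (x - r) * eval (quotient r cs) x ≡⟨ cong₂ (λ a b → a + (x - r) * b) cs[r]≡0 (eval≡0-from (quotient r cs) (suc s) quotient-vanish x) ⟩
    0ℚ + (x - r) * 0ℚ                            ≡⟨ trans (ℚₚ.+-identityˡ _) (ℚₚ.*-zeroʳ (x - r)) ⟩
    0ℚ                                           ∎
    where
    open ≡-Reasoning
    r = ℕtoℚ s
    cs[r]≡0 : eval cs r ≡ 0ℚ
    cs[r]≡0 = subst (λ n → eval cs (ℕtoℚ n) ≡ 0ℚ) (ℕₚ.+-identityʳ s) (vanish 0)
    quotient-vanish : ∀ i → eval (quotient r cs) (ℕtoℚ (suc s ℕ.+ i)) ≡ 0ℚ
    quotient-vanish i = *≡0⇒≡0 (ℕtoℚ-suc≢0 i) (begin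
      ℕtoℚ (suc i) * eval (quotient r cs) y        ≡⟨ cong (_* eval (quotient r cs) y) gap ⟩
      (y - r) * eval (quotient r cs) y             ≡⟨ sym (ℚₚ.+-identityˡ _) ⟩
      0ℚ + (y - r) * eval (quotient r cs) y        ≡⟨ cong (λ a → a + (y - r) * eval (quotient r cs) y) (sym cs[r]≡0) ⟩
      eval cs r + (y - r) * eval (quotient r cs) y ≡⟨ sym (eval-quotient r cs y) ⟩
      eval cs y                                    ≡⟨ subst (λ n → eval cs (ℕtoℚ n) ≡ 0ℚ) (ℕₚ.+-suc s i) (vanish (suc i)) ⟩
      0ℚ                                           ∎)
      where
      y = ℕtoℚ (suc s ℕ.+ i)
      gap : ℕtoℚ (suc i) ≡ y - r
      gap = begin
        ℕtoℚ (suc i)              ≡⟨ reshuffle (ℕtoℚ s) (ℕtoℚ (suc i)) ⟩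
        ℕtoℚ s + ℕtoℚ (suc i) - r ≡⟨ cong (_- r) (sym (ℕtoℚ-+ s (suc i))) ⟩
        ℕtoℚ (s ℕ.+ suc i) - r    ≡⟨ cong (λ n → ℕtoℚ n - r) (ℕₚ.+-suc s i) ⟩
        y - r                     ∎
        where
        reshuffle : ∀ a b → b ≡ a + b - a
        reshuffle = solve-∀ ℚ-ring

  poly-vanishing : ∀ {f} → IsPolynomial f → (∀ i → f (ℕtoℚ (suc i)) ≡ 0ℚ) → ∀ x → f x ≡ 0ℚ
  poly-vanishing (cs , f≗) vanish x =
    trans (f≗ x) (eval≡0-from (Vec.fromList cs) 1 (λ i → trans (sym (f≗ _)) (vanish i)) x)

  eval-≡-mod-power : ∀ j (us vs : Vec ℚ j) {E G : ℚ → ℚ} → IsPolynomial E → IsPolynomial G → E 0ℚ ≢ 0ℚ →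
    (∀ y → (eval us y - eval vs y) * E y + y ^ j * G y ≡ 0ℚ) → ∀ y → eval us y ≡ eval vs y
  eval-≡-mod-power zero    []       []       pE pG E0≢0 congruence y = refl
  eval-≡-mod-power (suc j) (a ∷ us) (b ∷ vs) {E} {G} pE pG E0≢0 congruence y =
    cong₂ (λ s t → s + y * t) a≡b (eval-≡-mod-power j us vs pE pG E0≢0 congruence′ y)
    where
    a≡b : a ≡ b
    a≡b = p-q≡0⇒p≡q (*≡0⇒≡0 E0≢0 (trans (sym (at-zero a b (eval us 0ℚ) (eval vs 0ℚ) (E 0ℚ) (0ℚ ^ j) (G 0ℚ))) (congruence 0ℚ)))
      where
      at-zero : ∀ a b s t e p g → ((a + 0ℚ * s) - (b + 0ℚ * t)) * e + (0ℚ * p) * g ≡ e * (a - b)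
      at-zero = solve-∀ ℚ-ring
    H : ℚ → ℚ
    H y = (eval us y - eval vs y) * E y + y ^ j * G y
    y*H≡0 : ∀ y → y * H y ≡ 0ℚ
    y*H≡0 y = trans (sym (shift a (eval us y) (eval vs y) y (E y) (y ^ j) (G y)))
                    (subst (λ b → ((a + y * eval us y) - (b + y * eval vs y)) * E y + (y * y ^ j) * G y ≡ 0ℚ) (sym a≡b) (congruence y))
      where
      shift : ∀ a s t y e p g → ((a + y * s) - (a + y * t)) * e + (y * p) * g ≡ y * ((s - t) * e + p * g)
      shift = solve-∀ ℚ-ring
    congruence′ : ∀ y → H y ≡ 0ℚ
    congruence′ = poly-vanishing (poly-+ (poly-* (poly-- (poly-eval us) (poly-eval vs)) pE) (poly-* (poly-^ poly-id j) pG))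
                                 (λ i → *≡0⇒≡0 (ℕtoℚ-suc≢0 i) (y*H≡0 (ℕtoℚ (suc i))))

  reflect : ∀ {k} → Vec ℚ k → Vec ℚ k
  reflect []       = []
  reflect (c ∷ cs) = c ∷ Vec.map -_ (reflect cs)

  eval-map-neg : ∀ {k} (cs : Vec ℚ k) x → eval (Vec.map -_ cs) x ≡ - eval cs x
  eval-map-neg []       x = refl
  eval-map-neg (c ∷ cs) x = trans (cong (λ s → - c + x * s) (eval-map-neg cs x)) (reshuffle c x (eval cs x))
    where
    reshuffle : ∀ c x s → - c + x * (- s) ≡ - (c + x * s)
    reshuffle = solve-∀ ℚ-ring

  eval-reflect : ∀ {k} (cs : Vec ℚ k) x → eval (reflect cs) x ≡ eval cs (- x)
  eval-reflect []       x = refl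
  eval-reflect (c ∷ cs) x =
    trans (cong (λ s → c + x * s) (trans (eval-map-neg (reflect cs) x) (cong -_ (eval-reflect cs x))))
          (reshuffle c x (eval cs (- x)))
    where
    reshuffle : ∀ c x s → c + x * (- s) ≡ c + (- x) * s
    reshuffle = solve-∀ ℚ-ring

  coefficients : (ℕ → ℚ) → (n : ℕ) → Vec ℚ (suc n)
  coefficients g zero    = g 0 ∷ []
  coefficients g (suc n) = g 0 ∷ coefficients (g ∘ suc) n

  partialSum : (ℕ → ℚ) → ℕ → ℚ → ℚ
  partialSum g n = eval (coefficients g n)

  partialSum-suc : ∀ g n x → partialSum g (suc n) x ≡ partialSum g n x + g (suc n) * x ^ suc n
  partialSum-suc g zero    x = reshuffle (g 0) (g 1) x
    where
    reshuffle : ∀ a b x → a + x * (b + x * 0ℚ) ≡ (a + x * 0ℚ) + b * (x * 1ℚ)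
    reshuffle = solve-∀ ℚ-ring
  partialSum-suc g (suc n) x =
    trans (cong (λ s → g 0 + x * s) (partialSum-suc (g ∘ suc) n x))
          (reshuffle (g 0) x (partialSum (g ∘ suc) n x) (g (suc (suc n))) (x ^ suc n))
    where
    reshuffle : ∀ a x s b p → a + x * (s + b * p) ≡ (a + x * s) + b * (x * p)
    reshuffle = solve-∀ ℚ-ring

  partialSum-telescope : ∀ {g h : ℕ → ℚ} → g 0 ≡ h 0 → (∀ k → g (suc k) ≡ g k + h (suc k)) →
    ∀ n x → (1ℚ - x) * partialSum g n x ≡ partialSum h n x - g n * x ^ suc n
  partialSum-telescope {g} {h} g₀≡h₀ g-step zero x =
    trans (reshuffle (g 0) x) (cong (λ a → (a + x * 0ℚ) - g 0 * (x * 1ℚ)) g₀≡h₀)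
    where
    reshuffle : ∀ a x → (1ℚ - x) * (a + x * 0ℚ) ≡ (a + x * 0ℚ) - a * (x * 1ℚ)
    reshuffle = solve-∀ ℚ-ring
  partialSum-telescope {g} {h} g₀≡h₀ g-step (suc n) x = begin
    (1ℚ - x) * partialSum g (suc n) x                         ≡⟨ cong ((1ℚ - x) *_) (partialSum-suc g n x) ⟩
    (1ℚ - x) * (partialSum g n x + g (suc n) * p)             ≡⟨ split x (partialSum g n x) (g (suc n)) p ⟩
    (1ℚ - x) * partialSum g n x + (1ℚ - x) * g (suc n) * p    ≡⟨ cong (_+ (1ℚ - x) * g (suc n) * p) (partialSum-telescope g₀≡h₀ g-step n x) ⟩
    partialSum h n x - g n * p + (1ℚ - x) * g (suc n) * p     ≡⟨ cong (λ b → partialSum h n x - g n * p + (1ℚ - x) * b * p) (g-step n) ⟩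
    partialSum h n x - g n * p + (1ℚ - x) * (g n + h (suc n)) * p
                                                              ≡⟨ regroup x (partialSum h n x) (g n) (h (suc n)) p ⟩
    (partialSum h n x + h (suc n) * p) - (g n + h (suc n)) * (x * p)
                                                              ≡⟨ cong₂ (λ a b → a - b * (x * p)) (sym (partialSum-suc h n x)) (sym (g-step n)) ⟩
    partialSum h (suc n) x - g (suc n) * x ^ suc (suc n)      ∎
    where
    open ≡-Reasoning
    p = x ^ suc n
    split : ∀ x s b p → (1ℚ - x) * (s + b * p) ≡ (1ℚ - x) * s + (1ℚ - x) * b * p
    split = solve-∀ ℚ-ring
    regroup : ∀ x s a b p → s - a * p + (1ℚ - x) * (a + b) * p ≡ (s + b * p) - (a + b) * (x * p)
    regroup = solve-∀ ℚ-ring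

open Polynomial

-- Binomial coefficients

absorption : ∀ n k → suc k ℕ.* (suc n C suc k) ≡ suc n ℕ.* (n C k)
absorption zero    zero    = refl
absorption zero    (suc k) = ℕₚ.*-zeroʳ (suc (suc k))
absorption (suc n) zero    = trans (ℕₚ.+-identityʳ _) (trans (nC1≡n (suc (suc n))) (sym (ℕₚ.*-identityʳ (suc (suc n)))))
absorption (suc n) (suc k) = begin
  suc (suc k) ℕ.* (suc (suc n) C suc (suc k))   ≡⟨ cong (suc (suc k) ℕ.*_) (sym (nCk+nC[k+1]≡[n+1]C[k+1] (suc n) (suc k))) ⟩
  suc (suc k) ℕ.* (A ℕ.+ B)                     ≡⟨ split k A B ⟩
  A ℕ.+ suc k ℕ.* A ℕ.+ suc (suc k) ℕ.* B       ≡⟨ cong₂ (λ s t → A ℕ.+ s ℕ.+ t) (absorption n k) (absorption n (suc k)) ⟩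
  A ℕ.+ suc n ℕ.* (n C k) ℕ.+ suc n ℕ.* (n C suc k) ≡⟨ join n A (n C k) (n C suc k) ⟩
  A ℕ.+ suc n ℕ.* (n C k ℕ.+ n C suc k)         ≡⟨ cong (λ s → A ℕ.+ suc n ℕ.* s) (nCk+nC[k+1]≡[n+1]C[k+1] n k) ⟩
  suc (suc n) ℕ.* A                             ∎
  where
  open ≡-Reasoning
  A = suc n C suc k
  B = suc n C suc (suc k)
  split : ∀ k a b → suc (suc k) ℕ.* (a ℕ.+ b) ≡ a ℕ.+ suc k ℕ.* a ℕ.+ suc (suc k) ℕ.* b
  split = ℕ-Solver.solve-∀
  join : ∀ n a s t → a ℕ.+ suc n ℕ.* s ℕ.+ suc n ℕ.* t ≡ a ℕ.+ suc n ℕ.* (s ℕ.+ t)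
  join = ℕ-Solver.solve-∀

C[2n+1,n+1]-double : ∀ n → 2 ℕ.* ((n ℕ.+ suc n) C suc n) ≡ (2 ℕ.* suc n) C suc n
C[2n+1,n+1]-double n = begin
  X ℕ.+ (X ℕ.+ 0)                        ≡⟨ cong (λ s → s ℕ.+ (X ℕ.+ 0)) (sym symmetric) ⟩
  (n ℕ.+ suc n) C n ℕ.+ (X ℕ.+ 0)        ≡⟨ cong ((n ℕ.+ suc n) C n ℕ.+_) (ℕₚ.+-identityʳ X) ⟩
  (n ℕ.+ suc n) C n ℕ.+ X                ≡⟨ nCk+nC[k+1]≡[n+1]C[k+1] (n ℕ.+ suc n) n ⟩
  suc (n ℕ.+ suc n) C suc n              ≡⟨ cong (λ m → suc (n ℕ.+ m) C suc n) (sym (ℕₚ.+-identityʳ (suc n))) ⟩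
  (2 ℕ.* suc n) C suc n                  ∎
  where
  open ≡-Reasoning
  X = (n ℕ.+ suc n) C suc n
  symmetric : (n ℕ.+ suc n) C n ≡ X
  symmetric = trans (nCk≡nC[n∸k] (ℕₚ.m≤m+n n (suc n))) (cong ((n ℕ.+ suc n) C_) (ℕₚ.m+n∸m≡n n (suc n)))

central-step-ℕ : ∀ n → suc n ℕ.* ((2 ℕ.* suc n) C suc n) ≡ 2 ℕ.* suc (2 ℕ.* n) ℕ.* ((2 ℕ.* n) C n)
central-step-ℕ n = begin
  suc n ℕ.* ((2 ℕ.* suc n) C suc n)            ≡⟨ cong (suc n ℕ.*_) (sym (C[2n+1,n+1]-double n)) ⟩
  suc n ℕ.* (2 ℕ.* X)                          ≡⟨ swap (suc n) X ⟩
  2 ℕ.* (suc n ℕ.* X)                          ≡⟨ cong (λ m → 2 ℕ.* (suc n ℕ.* (m C suc n))) n+[1+n]≡1+2n ⟩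
  2 ℕ.* (suc n ℕ.* (suc (2 ℕ.* n) C suc n))    ≡⟨ cong (2 ℕ.*_) (absorption (2 ℕ.* n) n) ⟩
  2 ℕ.* (suc (2 ℕ.* n) ℕ.* ((2 ℕ.* n) C n))    ≡⟨ sym (ℕₚ.*-assoc 2 (suc (2 ℕ.* n)) _) ⟩
  2 ℕ.* suc (2 ℕ.* n) ℕ.* ((2 ℕ.* n) C n)      ∎
  where
  open ≡-Reasoning
  X = (n ℕ.+ suc n) C suc n
  swap : ∀ a b → a ℕ.* (2 ℕ.* b) ≡ 2 ℕ.* (a ℕ.* b)
  swap = ℕ-Solver.solve-∀
  n+[1+n]≡1+2n : n ℕ.+ suc n ≡ suc (2 ℕ.* n)
  n+[1+n]≡1+2n = trans (ℕₚ.+-suc n n) (cong (λ m → suc (n ℕ.+ m)) (sym (ℕₚ.+-identityʳ n)))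

ℕtoℚ-2n+1 : ∀ n → ℕtoℚ (suc (2 ℕ.* n)) ≡ two * ℕtoℚ n + 1ℚ
ℕtoℚ-2n+1 n = trans (ℕtoℚ-suc (2 ℕ.* n)) (cong (_+ 1ℚ) (ℕtoℚ-* 2 n))

central : ℕ → ℚ
central n = ℕtoℚ ((2 ℕ.* n) C n)

central≢0 : ∀ n → central n ≢ 0ℚ
central≢0 n = ℕtoℚ-≢0 (C≢0 (2 ℕ.* n) n (ℕₚ.m≤m+n n (n ℕ.+ 0)))

central-step : ∀ n → (ℕtoℚ n + 1ℚ) * central (suc n) ≡ two * (two * ℕtoℚ n + 1ℚ) * central n
central-step n = begin
  (ℕtoℚ n + 1ℚ) * central (suc n)                            ≡⟨ cong (_* central (suc n)) (sym (ℕtoℚ-suc n)) ⟩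
  ℕtoℚ (suc n) * central (suc n)                             ≡⟨ sym (ℕtoℚ-* (suc n) ((2 ℕ.* suc n) C suc n)) ⟩
  ℕtoℚ (suc n ℕ.* ((2 ℕ.* suc n) C suc n))                   ≡⟨ cong ℕtoℚ (central-step-ℕ n) ⟩
  ℕtoℚ (2 ℕ.* suc (2 ℕ.* n) ℕ.* ((2 ℕ.* n) C n))             ≡⟨ ℕtoℚ-* (2 ℕ.* suc (2 ℕ.* n)) ((2 ℕ.* n) C n) ⟩
  ℕtoℚ (2 ℕ.* suc (2 ℕ.* n)) * central n                     ≡⟨ cong (_* central n) (trans (ℕtoℚ-* 2 (suc (2 ℕ.* n))) (cong (two *_) (ℕtoℚ-2n+1 n))) ⟩
  two * (two * ℕtoℚ n + 1ℚ) * central n                      ∎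
  where open ≡-Reasoning

-- Truncated binomial series

-- the coefficient of y^k in (1 - y)^(-b)
negBinomial : ℕ → ℕ → ℚ
negBinomial b k = ℕtoℚ ((b ℕ.+ k ∸ 1) C k)

negBinomial-pascal : ∀ b k → negBinomial (suc b) (suc k) ≡ negBinomial (suc b) k + negBinomial b (suc k)
negBinomial-pascal b k = begin
  ℕtoℚ ((b ℕ.+ suc k) C suc k)                           ≡⟨ cong (λ n → ℕtoℚ (n C suc k)) (ℕₚ.+-suc b k) ⟩
  ℕtoℚ (suc (b ℕ.+ k) C suc k)                           ≡⟨ cong ℕtoℚ (sym (nCk+nC[k+1]≡[n+1]C[k+1] (b ℕ.+ k) k)) ⟩
  ℕtoℚ ((b ℕ.+ k) C k ℕ.+ (b ℕ.+ k) C suc k)             ≡⟨ ℕtoℚ-+ ((b ℕ.+ k) C k) _ ⟩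
  ℕtoℚ ((b ℕ.+ k) C k) + ℕtoℚ ((b ℕ.+ k) C suc k)        ≡⟨ cong (λ n → ℕtoℚ ((b ℕ.+ k) C k) + ℕtoℚ ((n ∸ 1) C suc k)) (sym (ℕₚ.+-suc b k)) ⟩
  negBinomial (suc b) k + negBinomial b (suc k)          ∎
  where open ≡-Reasoning

partialSum-negBinomial-0 : ∀ n x → partialSum (negBinomial 0) n x ≡ 1ℚ
partialSum-negBinomial-0 zero    x = trans (cong (λ s → 1ℚ + s) (ℚₚ.*-zeroʳ x)) (ℚₚ.+-identityʳ 1ℚ)
partialSum-negBinomial-0 (suc n) x = begin
  partialSum (negBinomial 0) (suc n) x                       ≡⟨ partialSum-suc (negBinomial 0) n x ⟩
  partialSum (negBinomial 0) n x + negBinomial 0 (suc n) * x ^ suc n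
                                                             ≡⟨ cong₂ (λ s t → s + t * x ^ suc n) (partialSum-negBinomial-0 n x) (cong ℕtoℚ (k>n⇒nCk≡0 (ℕₚ.n<1+n n))) ⟩
  1ℚ + 0ℚ * x ^ suc n                                        ≡⟨ trans (cong (λ s → 1ℚ + s) (ℚₚ.*-zeroˡ (x ^ suc n))) (ℚₚ.+-identityʳ 1ℚ) ⟩
  1ℚ                                                         ∎
  where open ≡-Reasoning

negBinomial-series-inverse : ∀ b n → ∃[ K ] (IsPolynomial K × (∀ y → (1ℚ - y) ^ b * partialSum (negBinomial b) n y ≡ 1ℚ + y ^ suc n * K y))
negBinomial-series-inverse zero n = (λ _ → 0ℚ) , poly-const 0ℚ , λ y →
  trans (trans (ℚₚ.*-identityˡ _) (partialSum-negBinomial-0 n y)) (sym (trans (cong (λ s → 1ℚ + s) (ℚₚ.*-zeroʳ (y ^ suc n))) (ℚₚ.+-identityʳ 1ℚ)))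
negBinomial-series-inverse (suc b) n with negBinomial-series-inverse b n
... | K , pK , K-spec = K′ , poly-- pK (poly-* (poly-const d) (poly-^ (poly-- (poly-const 1ℚ) poly-id) b)) , K′-spec
  where
  d = negBinomial (suc b) n
  K′ : ℚ → ℚ
  K′ y = K y - d * (1ℚ - y) ^ b
  K′-spec : ∀ y → (1ℚ - y) ^ suc b * partialSum (negBinomial (suc b)) n y ≡ 1ℚ + y ^ suc n * K′ y
  K′-spec y = begin
    (1ℚ - y) * E * S′                        ≡⟨ swap (1ℚ - y) E S′ ⟩
    E * ((1ℚ - y) * S′)                      ≡⟨ cong (E *_) (partialSum-telescope refl (negBinomial-pascal b) n y) ⟩
    E * (S - d * Y)                          ≡⟨ distrib E S d Y ⟩
    E * S - d * Y * E                        ≡⟨ cong (_- d * Y * E) (K-spec y) ⟩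
    1ℚ + Y * K y - d * Y * E                 ≡⟨ factor Y (K y) d E ⟩
    1ℚ + Y * (K y - d * E)                   ∎
    where
    open ≡-Reasoning
    E = (1ℚ - y) ^ b
    S = partialSum (negBinomial b) n y
    S′ = partialSum (negBinomial (suc b)) n y
    Y = y ^ suc n
    swap : ∀ a e s → a * e * s ≡ e * (a * s)
    swap = solve-∀ ℚ-ring
    distrib : ∀ e s d y → e * (s - d * y) ≡ e * s - d * y * e
    distrib = solve-∀ ℚ-ring
    factor : ∀ y k d e → 1ℚ + y * k - d * y * e ≡ 1ℚ + y * (k - d * e)
    factor = solve-∀ ℚ-ring

-- Σ_{k ≤ m} C(m + k, k) y^k, which will turn out to be Q_m(-y)
S : ℕ → ℚ → ℚ
S m = partialSum (negBinomial (suc m)) m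

step-from-telescope : ∀ {x w s s₋ e f c} → (1ℚ - x) * s ≡ (s₋ + e * w) - f * (x * w) → two * e ≡ c → f ≡ c →
  two * (1ℚ - x) * s ≡ two * s₋ + c * (w * (1ℚ - two * x))
step-from-telescope {x} {w} {s} {s₋} {e} telescope refl refl = begin
  two * (1ℚ - x) * s                                ≡⟨ solve (x ∷ s ∷ []) ℚ-ring ⟩
  two * ((1ℚ - x) * s)                              ≡⟨ cong (two *_) telescope ⟩
  two * ((s₋ + e * w) - two * e * (x * w))          ≡⟨ solve (x ∷ w ∷ s₋ ∷ e ∷ []) ℚ-ring ⟩
  two * s₋ + two * e * (w * (1ℚ - two * x))         ∎
  where open ≡-Reasoning

S-step : ∀ i x → two * (1ℚ - x) * S (suc i) x ≡ two * S i x + central (suc i) * (x ^ suc i * (1ℚ - two * x))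
S-step i x = step-from-telescope {x} {x ^ suc i} {S (suc i) x} {S i x} {negBinomial (suc i) (suc i)}
                                 {negBinomial (suc (suc i)) (suc i)} {central (suc i)} telescope diagonal subdiagonal
  where
  telescope : (1ℚ - x) * S (suc i) x ≡ (S i x + negBinomial (suc i) (suc i) * x ^ suc i) - negBinomial (suc (suc i)) (suc i) * (x * x ^ suc i)
  telescope = trans (partialSum-telescope {negBinomial (suc (suc i))} {negBinomial (suc i)} refl (negBinomial-pascal (suc i)) (suc i) x)
                    (cong (_- negBinomial (suc (suc i)) (suc i) * (x * x ^ suc i)) (partialSum-suc (negBinomial (suc i)) i x))
  diagonal : two * negBinomial (suc i) (suc i) ≡ central (suc i)
  diagonal = trans (sym (ℕtoℚ-* 2 ((i ℕ.+ suc i) C suc i))) (cong ℕtoℚ (C[2n+1,n+1]-double i))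
  subdiagonal : negBinomial (suc (suc i)) (suc i) ≡ central (suc i)
  subdiagonal = cong (λ n → ℕtoℚ ((suc i ℕ.+ n) C suc i)) (sym (ℕₚ.+-identityʳ (suc i)))

-- The algebra of consecutive steps

-- In the intended instance q₋, q, q₊ are q_(n-1)(x), q_n(x), q_(n+1)(x), w = x^n, c = C(2n, n),
-- c′ = C(2n+2, n+1) and a = n.
module _ {x w c c′ q₋ q q₊ : ℚ}
         (step : two * (1ℚ - x) * q ≡ two * q₋ + c * (w * (1ℚ - two * x)))
         (step′ : two * (1ℚ - x) * q₊ ≡ two * q + c′ * ((x * w) * (1ℚ - two * x))) where

  turán-identity : two * (1ℚ - x) * (q * q - q₋ * q₊) ≡ w * (1ℚ - two * x) * (c * q - c′ * x * q₋)
  turán-identity = begin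
    two * (1ℚ - x) * (q * q - q₋ * q₊)                                ≡⟨ solve (x ∷ q₋ ∷ q ∷ q₊ ∷ []) ℚ-ring ⟩
    q * (two * (1ℚ - x) * q) - q₋ * (two * (1ℚ - x) * q₊)             ≡⟨ cong₂ (λ s t → q * s - q₋ * t) step step′ ⟩
    q * (two * q₋ + c * (w * (1ℚ - two * x)))
      - q₋ * (two * q + c′ * ((x * w) * (1ℚ - two * x)))             ≡⟨ solve (x ∷ w ∷ c ∷ c′ ∷ q₋ ∷ q ∷ []) ℚ-ring ⟩
    w * (1ℚ - two * x) * (c * q - c′ * x * q₋)                        ∎
    where open ≡-Reasoning

  three-term : ∀ {a} → (a + 1ℚ) * c′ ≡ two * (two * a + 1ℚ) * c →
    (a + 1ℚ) * (two * (1ℚ - x) * q₊ - two * q) ≡ two * (two * a + 1ℚ) * x * (two * (1ℚ - x) * q - two * q₋)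
  three-term {a} central-step = begin
    (a + 1ℚ) * (two * (1ℚ - x) * q₊ - two * q)                        ≡⟨ cong (λ s → (a + 1ℚ) * (s - two * q)) step′ ⟩
    (a + 1ℚ) * (two * q + c′ * ((x * w) * (1ℚ - two * x)) - two * q)  ≡⟨ solve (a ∷ x ∷ w ∷ c′ ∷ q ∷ []) ℚ-ring ⟩
    (a + 1ℚ) * c′ * (x * w * (1ℚ - two * x))                          ≡⟨ cong (_* (x * w * (1ℚ - two * x))) central-step ⟩
    two * (two * a + 1ℚ) * c * (x * w * (1ℚ - two * x))               ≡⟨ solve (a ∷ x ∷ w ∷ c ∷ q₋ ∷ []) ℚ-ring ⟩
    two * (two * a + 1ℚ) * x * (two * q₋ + c * (w * (1ℚ - two * x)) - two * q₋) ≡⟨ cong (λ s → two * (two * a + 1ℚ) * x * (s - two * q₋)) (sym step) ⟩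
    two * (two * a + 1ℚ) * x * (two * (1ℚ - x) * q - two * q₋)        ∎
    where open ≡-Reasoning

  closed-form : ∀ {a V} → c ≢ 0ℚ → w * (1ℚ - two * x) ≢ 0ℚ →
    c * (V * (w * (1ℚ - two * x))) ≡ two * (a + 1ℚ) * (q * q - q₋ * q₊) →
    (a + 1ℚ) * c′ ≡ two * (two * a + 1ℚ) * c →
    (1ℚ - x) * V ≡ (a + 1ℚ) * q - two * (two * a + 1ℚ) * x * q₋
  closed-form {a} {V} c≢0 Δ≢0 spec central-step = *-cancelˡ-≢0 (*-≢0 (*-≢0 two≢0 c≢0) Δ≢0) (begin
    two * c * (w * (1ℚ - two * x)) * ((1ℚ - x) * V)
      ≡⟨ solve (x ∷ w ∷ c ∷ V ∷ []) ℚ-ring ⟩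
    two * (1ℚ - x) * (c * (V * (w * (1ℚ - two * x))))
      ≡⟨ cong (two * (1ℚ - x) *_) spec ⟩
    two * (1ℚ - x) * (two * (a + 1ℚ) * (q * q - q₋ * q₊))
      ≡⟨ solve (x ∷ a ∷ q₋ ∷ q ∷ q₊ ∷ []) ℚ-ring ⟩
    two * (a + 1ℚ) * (two * (1ℚ - x) * (q * q - q₋ * q₊))
      ≡⟨ cong (two * (a + 1ℚ) *_) turán-identity ⟩
    two * (a + 1ℚ) * (w * (1ℚ - two * x) * (c * q - c′ * x * q₋))
      ≡⟨ solve (x ∷ w ∷ a ∷ c ∷ c′ ∷ q₋ ∷ q ∷ []) ℚ-ring ⟩
    two * (w * (1ℚ - two * x)) * (c * (a + 1ℚ) * q - (a + 1ℚ) * c′ * x * q₋)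
      ≡⟨ cong (λ s → two * (w * (1ℚ - two * x)) * (c * (a + 1ℚ) * q - s * x * q₋)) central-step ⟩
    two * (w * (1ℚ - two * x)) * (c * (a + 1ℚ) * q - two * (two * a + 1ℚ) * c * x * q₋)
      ≡⟨ solve (x ∷ w ∷ a ∷ c ∷ q₋ ∷ q ∷ []) ℚ-ring ⟩
    two * c * (w * (1ℚ - two * x)) * ((a + 1ℚ) * q - two * (two * a + 1ℚ) * x * q₋) ∎)
    where open ≡-Reasoning

recurrence-off-one : ∀ {x a a₁ a₂ μ μ′ q₀ q₁ q₂ q₃ V₀ V₁ V₂} →
  a₁ ≡ a + 1ℚ → a₂ ≡ a₁ + 1ℚ → μ ≡ two * a + 1ℚ → μ′ ≡ two * a₁ + 1ℚ → 1ℚ - x ≢ 0ℚ →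
  (1ℚ - x) * V₀ ≡ (a + 1ℚ) * q₁ - two * (two * a + 1ℚ) * x * q₀ →
  (1ℚ - x) * V₁ ≡ (a₁ + 1ℚ) * q₂ - two * (two * a₁ + 1ℚ) * x * q₁ →
  (1ℚ - x) * V₂ ≡ (a₂ + 1ℚ) * q₃ - two * (two * a₂ + 1ℚ) * x * q₂ →
  (a + 1ℚ) * (two * (1ℚ - x) * q₂ - two * q₁) ≡ two * (two * a + 1ℚ) * x * (two * (1ℚ - x) * q₁ - two * q₀) →
  (a₁ + 1ℚ) * (two * (1ℚ - x) * q₃ - two * q₂) ≡ two * (two * a₁ + 1ℚ) * x * (two * (1ℚ - x) * q₂ - two * q₁) →
  a₂ * (x - 1ℚ) * V₂ ≡ (two * μ * x * (x - 1ℚ) - a₂ - 1ℚ) * V₁ + two * μ′ * x * V₀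
recurrence-off-one {x} {a} {q₀ = q₀} {q₁} {q₂} {q₃} {V₀} {V₁} {V₂} refl refl refl refl x≢1 closed₀ closed₁ closed₂ three₀ three₁ =
  let n = a + 1ℚ + 1ℚ
      α = two * (two * a + 1ℚ) * x * (x - 1ℚ) - n - 1ℚ
      β = two * (two * (a + 1ℚ) + 1ℚ) * x
      F₀ = (a + 1ℚ) * q₁ - two * (two * a + 1ℚ) * x * q₀
      F₁ = (a + 1ℚ + 1ℚ) * q₂ - two * (two * (a + 1ℚ) + 1ℚ) * x * q₁
      F₂ = (n + 1ℚ) * q₃ - two * (two * n + 1ℚ) * x * q₂
  in *-cancelˡ-≢0 (*-≢0 two≢0 x≢1) (begin
    two * (1ℚ - x) * (n * (x - 1ℚ) * V₂)        ≡⟨ solve (x ∷ a ∷ V₂ ∷ []) ℚ-ring ⟩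
    two * n * (x - 1ℚ) * ((1ℚ - x) * V₂)        ≡⟨ cong (two * n * (x - 1ℚ) *_) closed₂ ⟩
    two * n * (x - 1ℚ) * F₂                     -- −(n + 1) times the later three-term relation plus 2(2n − 1) x times the earlier one
                                                ≡⟨ linear-combination₂ (- (n + 1ℚ)) (two * (two * (a + 1ℚ) + 1ℚ) * x) three₁ three₀
                                                     (solve (x ∷ a ∷ q₀ ∷ q₁ ∷ q₂ ∷ q₃ ∷ []) ℚ-ring) ⟩
    two * (α * F₁ + β * F₀)                     ≡⟨ cong₂ (λ s t → two * (α * s + β * t)) (sym closed₁) (sym closed₀) ⟩
    two * (α * ((1ℚ - x) * V₁) + β * ((1ℚ - x) * V₀)) ≡⟨ solve (x ∷ a ∷ V₀ ∷ V₁ ∷ []) ℚ-ring ⟩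
    two * (1ℚ - x) * (α * V₁ + β * V₀)          ∎)
  where open ≡-Reasoning

value-at-one : ∀ {a a₁ c c′ c″ q₋ q q₊ V} → a₁ ≡ a + 1ℚ → c ≢ 0ℚ →
  c * (V * (- 1ℚ)) ≡ two * (a + 1ℚ) * (q * q - q₋ * q₊) →
  two * q₋ ≡ c → two * q ≡ c′ → two * q₊ ≡ c″ →
  (a + 1ℚ) * c′ ≡ two * (two * a + 1ℚ) * c →
  (a₁ + 1ℚ) * c″ ≡ two * (two * a₁ + 1ℚ) * c′ →
  (a₁ + 1ℚ) * V ≡ c′
value-at-one {a} {c = c} {c′} {c″} {q₋} {q} {q₊} {V} refl c≢0 spec q₋≡ q≡ q₊≡ step step′ =
  *-cancelˡ-≢0 (*-≢0 four≢0 c≢0) (begin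
    four * c * ((a + 1ℚ + 1ℚ) * V)
      ≡⟨ solve (a ∷ c ∷ V ∷ []) ℚ-ring ⟩
    - (four * (a + 1ℚ + 1ℚ)) * (c * (V * (- 1ℚ)))
      ≡⟨ cong (- (four * (a + 1ℚ + 1ℚ)) *_) spec ⟩
    - (four * (a + 1ℚ + 1ℚ)) * (two * (a + 1ℚ) * (q * q - q₋ * q₊))
      ≡⟨ solve (a ∷ q₋ ∷ q ∷ q₊ ∷ []) ℚ-ring ⟩
    - (two * (a + 1ℚ)) * ((a + 1ℚ + 1ℚ) * ((two * q) * (two * q)) - (two * q₋) * ((a + 1ℚ + 1ℚ) * (two * q₊)))
      ≡⟨ cong₂ (λ s t → - (two * (a + 1ℚ)) * ((a + 1ℚ + 1ℚ) * (s * s) - t)) q≡ (cong₂ (λ s t → s * ((a + 1ℚ + 1ℚ) * t)) q₋≡ q₊≡) ⟩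
    - (two * (a + 1ℚ)) * ((a + 1ℚ + 1ℚ) * (c′ * c′) - c * ((a + 1ℚ + 1ℚ) * c″))
      ≡⟨ cong (λ s → - (two * (a + 1ℚ)) * ((a + 1ℚ + 1ℚ) * (c′ * c′) - c * s)) step′ ⟩
    - (two * (a + 1ℚ)) * ((a + 1ℚ + 1ℚ) * (c′ * c′) - c * (two * (two * (a + 1ℚ) + 1ℚ) * c′))
      ≡⟨ solve (a ∷ c ∷ c′ ∷ []) ℚ-ring ⟩
    two * c′ * (two * (two * (a + 1ℚ) + 1ℚ) * (a + 1ℚ) * c - (a + 1ℚ + 1ℚ) * ((a + 1ℚ) * c′))
      ≡⟨ cong (λ s → two * c′ * (two * (two * (a + 1ℚ) + 1ℚ) * (a + 1ℚ) * c - (a + 1ℚ + 1ℚ) * s)) step ⟩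
    two * c′ * (two * (two * (a + 1ℚ) + 1ℚ) * (a + 1ℚ) * c - (a + 1ℚ + 1ℚ) * (two * (two * a + 1ℚ) * c))
      ≡⟨ solve (a ∷ c ∷ c′ ∷ []) ℚ-ring ⟩
    four * c * c′ ∎)
  where
  open ≡-Reasoning
  four = two * two
  four≢0 : four ≢ 0ℚ
  four≢0 ()

recurrence-at-one : ∀ {a a₁ a₂ μ μ′ c₁ c₂ V₀ V₁ V₂} →
  a₁ ≡ a + 1ℚ → a₂ ≡ a₁ + 1ℚ → μ ≡ two * a + 1ℚ → μ′ ≡ two * a₁ + 1ℚ → a₂ ≢ 0ℚ →
  (a₁ + 1ℚ) * V₀ ≡ c₁ → (a₂ + 1ℚ) * V₁ ≡ c₂ → (a₁ + 1ℚ) * c₂ ≡ two * (two * a₁ + 1ℚ) * c₁ →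
  a₂ * (1ℚ - 1ℚ) * V₂ ≡ (two * μ * 1ℚ * (1ℚ - 1ℚ) - a₂ - 1ℚ) * V₁ + two * μ′ * 1ℚ * V₀
recurrence-at-one {a} {c₁ = c₁} {c₂} {V₀} {V₁} {V₂} refl refl refl refl n≢0 value₀ value₁ step =
  let n = a + 1ℚ + 1ℚ in
  *-cancelˡ-≢0 n≢0 (begin
    n * (n * (1ℚ - 1ℚ) * V₂)
      ≡⟨ solve (a ∷ V₂ ∷ c₁ ∷ []) ℚ-ring ⟩
    two * (two * (a + 1ℚ) + 1ℚ) * c₁ - two * (two * (a + 1ℚ) + 1ℚ) * c₁
      ≡⟨ cong (λ s → two * (two * (a + 1ℚ) + 1ℚ) * c₁ - s) (sym step) ⟩
    two * (two * (a + 1ℚ) + 1ℚ) * c₁ - (a + 1ℚ + 1ℚ) * c₂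
      ≡⟨ cong₂ (λ s t → two * (two * (a + 1ℚ) + 1ℚ) * s - (a + 1ℚ + 1ℚ) * t) (sym value₀) (sym value₁) ⟩
    two * (two * (a + 1ℚ) + 1ℚ) * ((a + 1ℚ + 1ℚ) * V₀) - (a + 1ℚ + 1ℚ) * ((n + 1ℚ) * V₁)
      ≡⟨ solve (a ∷ V₀ ∷ V₁ ∷ []) ℚ-ring ⟩
    n * ((two * (two * a + 1ℚ) * 1ℚ * (1ℚ - 1ℚ) - n - 1ℚ) * V₁ + two * (two * (a + 1ℚ) + 1ℚ) * 1ℚ * V₀) ∎)
  where open ≡-Reasoning

cancel-factor : ∀ {c V Δ T U} → c * Δ ≢ 0ℚ → c * (V * Δ) ≡ T → T ≡ c * Δ * U → V ≡ U
cancel-factor {c} {V} {Δ} {T} {U} cΔ≢0 spec T≡ = *-cancelˡ-≢0 cΔ≢0 (begin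
  c * Δ * V     ≡⟨ solve (c ∷ V ∷ Δ ∷ []) ℚ-ring ⟩
  c * (V * Δ)   ≡⟨ spec ⟩
  T             ≡⟨ T≡ ⟩
  c * Δ * U     ∎)
  where open ≡-Reasoning

q : ((m : ℕ) → Poly≤ m) → ℕ → ℚ → ℚ
q Q n x = eval (Q n) (- x)

turán : ((m : ℕ) → Poly≤ m) → ℕ → ℚ → ℚ
turán Q k x = q Q (suc k) x * q Q (suc k) x - q Q k x * q Q (suc (suc k)) x

V-spec : ∀ Q k x (x≢0 : x ≢ 0ℚ) (h : 1ℚ - two * x ≢ 0ℚ) →
  central (suc k) * (V Q (suc k) x x≢0 h * (x ^ suc k * (1ℚ - two * x))) ≡ two * (ℕtoℚ (suc k) + 1ℚ) * turán Q k x
V-spec Q k x x≢0 h = begin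
  c * (V Q n x x≢0 h * Δ)  ≡⟨ cong (c *_) (÷-*-cancel (r * turán Q k x) Δ) ⟩
  c * (r * turán Q k x)    ≡⟨ sym (ℚₚ.*-assoc c r (turán Q k x)) ⟩
  c * r * turán Q k x      ≡⟨ cong (_* turán Q k x) (trans (ℚₚ.*-comm c r) (/-*-cancel (2 ℕ.* (n ℕ.+ 1)) ((2 ℕ.* n) C n))) ⟩
  ℕtoℚ (2 ℕ.* (n ℕ.+ 1)) * turán Q k x ≡⟨ cong (_* turán Q k x) (trans (ℕtoℚ-* 2 (n ℕ.+ 1)) (cong (two *_) (ℕtoℚ-+ n 1))) ⟩
  two * (ℕtoℚ n + 1ℚ) * turán Q k x ∎
  where
  open ≡-Reasoning
  n = suc k
  c = central n
  Δ = x ^ n * (1ℚ - two * x)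
  instance
    Δ-nonZero = ≢-nonZero (*-≢0 (^-≢0 n x≢0) h)
    binomial-nonZero = ℕ.≢-nonZero (C≢0 (2 ℕ.* n) n (ℕₚ.m≤m+n n (n ℕ.+ 0)))
  r = ℤ.+ (2 ℕ.* (n ℕ.+ 1)) / ((2 ℕ.* n) C n)

ℕtoℚ-2[3+m]∸3 : ∀ m → ℕtoℚ (2 ℕ.* (3 ℕ.+ m) ∸ 3) ≡ two * ℕtoℚ (1 ℕ.+ m) + 1ℚ
ℕtoℚ-2[3+m]∸3 m = trans (cong ℕtoℚ (reduced m)) (ℕtoℚ-2n+1 (suc m))
  where
  reduced : ∀ m → m ℕ.+ (3 ℕ.+ m ℕ.+ 0) ≡ suc (2 ℕ.* suc m)
  reduced = ℕ-Solver.solve-∀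

ℕtoℚ-2[3+m]∸1 : ∀ m → ℕtoℚ (2 ℕ.* (3 ℕ.+ m) ∸ 1) ≡ two * ℕtoℚ (2 ℕ.+ m) + 1ℚ
ℕtoℚ-2[3+m]∸1 m = trans (cong ℕtoℚ (reduced m)) (ℕtoℚ-2n+1 (2 ℕ.+ m))
  where
  reduced : ∀ m → suc (suc (m ℕ.+ (3 ℕ.+ m ℕ.+ 0))) ≡ suc (2 ℕ.* (2 ℕ.+ m))
  reduced = ℕ-Solver.solve-∀

-- Implicit arguments of the algebraic lemmas are supplied by hand below: inferring them by
-- unification makes Agda unfold rational arithmetic on open terms.
module _ {P Q : (m : ℕ) → Poly≤ m} (bezout : IsBezoutFamily P Q) where

  q-explicit : ∀ m y → q Q m y ≡ S m y
  q-explicit m y =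
    trans (sym (eval-reflect (Q m) y))
          (eval-≡-mod-power (suc m) (reflect (Q m)) (coefficients (negBinomial (suc m)) m) {E} {G} pE pG E0≢0 congruence y)
    where
    K : ℚ → ℚ
    K = proj₁ (negBinomial-series-inverse (suc m) m)
    pK : IsPolynomial K
    pK = proj₁ (proj₂ (negBinomial-series-inverse (suc m) m))
    K-spec : ∀ y → (1ℚ - y) ^ suc m * S m y ≡ 1ℚ + y ^ suc m * K y
    K-spec = proj₂ (proj₂ (negBinomial-series-inverse (suc m) m))
    σ = (- 1ℚ) ^ suc m
    E G : ℚ → ℚ
    E y = (1ℚ - y) ^ suc m
    G y = σ * eval (reflect (P m)) y + K y
    pE : IsPolynomial E
    pE = poly-^ (poly-- (poly-const 1ℚ) poly-id) (suc m)
    pG : IsPolynomial G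
    pG = poly-+ (poly-* (poly-const σ) (poly-eval (reflect (P m)))) pK
    E0≢0 : E 0ℚ ≢ 0ℚ
    E0≢0 E0≡0 = ℕtoℚ-suc≢0 0 (trans (sym (1^n≡1 (suc m))) (trans (cong (_^ suc m) 1≡1-0) E0≡0))
      where
      1≡1-0 : 1ℚ ≡ 1ℚ - 0ℚ
      1≡1-0 = refl
    congruence : ∀ y → (eval (reflect (Q m)) y - S m y) * E y + y ^ suc m * G y ≡ 0ℚ
    congruence y = begin
      (Qy - S m y) * E y + Y * (σ * Py + K y)                  ≡⟨ regroup Qy (S m y) (E y) Y σ Py (K y) ⟩
      (Py * (σ * Y) + Qy * E y - 1ℚ) - (E y * S m y - (1ℚ + Y * K y))
                                                               ≡⟨ cong₂ (λ s t → (s - 1ℚ) - (t - (1ℚ + Y * K y))) bezout-at-−y (K-spec y) ⟩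
      (1ℚ - 1ℚ) - ((1ℚ + Y * K y) - (1ℚ + Y * K y))            ≡⟨ cancel (1ℚ + Y * K y) ⟩
      0ℚ                                                       ∎
      where
      open ≡-Reasoning
      Qy = eval (reflect (Q m)) y
      Py = eval (reflect (P m)) y
      Y = y ^ suc m
      regroup : ∀ q s e Y σ p k → (q - s) * e + Y * (σ * p + k) ≡ (p * (σ * Y) + q * e - 1ℚ) - (e * s - (1ℚ + Y * k))
      regroup = solve-∀ ℚ-ring
      cancel : ∀ a → (1ℚ - 1ℚ) - (a - a) ≡ 0ℚ
      cancel = solve-∀ ℚ-ring
      −y≡−1*y : ∀ y → - y ≡ (- 1ℚ) * y
      −y≡−1*y = solve-∀ ℚ-ring
      −y+1≡1−y : ∀ y → - y + 1ℚ ≡ 1ℚ - y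
      −y+1≡1−y = solve-∀ ℚ-ring
      bezout-at-−y : Py * (σ * Y) + Qy * E y ≡ 1ℚ
      bezout-at-−y = begin
        Py * (σ * Y) + Qy * E y   ≡⟨ cong₂ (λ s t → Py * s + Qy * t ^ suc m)
                                       (sym (trans (cong (_^ suc m) (−y≡−1*y y)) (^-distribʳ-* (- 1ℚ) y (suc m))))
                                       (sym (−y+1≡1−y y)) ⟩
        Py * (- y) ^ suc m + Qy * (- y + 1ℚ) ^ suc m ≡⟨ cong₂ (λ s t → s * (- y) ^ suc m + t * (- y + 1ℚ) ^ suc m) (eval-reflect (P m) y) (eval-reflect (Q m) y) ⟩
        eval (P m) (- y) * (- y) ^ suc m + eval (Q m) (- y) * (- y + 1ℚ) ^ suc m ≡⟨ bezout m (- y) ⟩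
        1ℚ ∎

  q-step : ∀ i x → two * (1ℚ - x) * q Q (suc i) x ≡ two * q Q i x + central (suc i) * (x ^ suc i * (1ℚ - two * x))
  q-step i x = subst₂ (λ s t → two * (1ℚ - x) * s ≡ two * t + central (suc i) * (x ^ suc i * (1ℚ - two * x)))
                      (sym (q-explicit (suc i) x)) (sym (q-explicit i x)) (S-step i x)

  turán-explicit : ∀ k x → turán Q k x ≡ S (suc k) x * S (suc k) x - S k x * S (suc (suc k)) x
  turán-explicit k x = cong₂ _-_ (cong₂ _*_ (q-explicit (suc k) x) (q-explicit (suc k) x)) (cong₂ _*_ (q-explicit k x) (q-explicit (suc (suc k)) x))

  q-three-term : ∀ i x → (ℕtoℚ (suc i) + 1ℚ) * (two * (1ℚ - x) * q Q (suc (suc i)) x - two * q Q (suc i) x)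
                           ≡ two * (two * ℕtoℚ (suc i) + 1ℚ) * x * (two * (1ℚ - x) * q Q (suc i) x - two * q Q i x)
  q-three-term i x = three-term {x} {x ^ suc i} {central (suc i)} {central (suc (suc i))} {q Q i x} {q Q (suc i) x} {q Q (suc (suc i)) x}
                                (q-step i x) (q-step (suc i) x) {ℕtoℚ (suc i)} (central-step (suc i))

  V-closed-form : ∀ i x (x≢0 : x ≢ 0ℚ) (h : 1ℚ - two * x ≢ 0ℚ) →
    (1ℚ - x) * V Q (suc i) x x≢0 h ≡ (ℕtoℚ (suc i) + 1ℚ) * q Q (suc i) x - two * (two * ℕtoℚ (suc i) + 1ℚ) * x * q Q i x
  V-closed-form i x x≢0 h =
    closed-form {x} {x ^ suc i} {central (suc i)} {central (suc (suc i))} {q Q i x} {q Q (suc i) x} {q Q (suc (suc i)) x}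
                (q-step i x) (q-step (suc i) x) {ℕtoℚ (suc i)} {V Q (suc i) x x≢0 h}
                (central≢0 (suc i)) (*-≢0 (^-≢0 (suc i) x≢0) h) (V-spec Q i x x≢0 h) (central-step (suc i))

  q-at-one : ∀ i → two * q Q i 1ℚ ≡ central (suc i)
  q-at-one i = begin
    two * q Q i 1ℚ
      ≡⟨ expand (q Q i 1ℚ) (central (suc i)) ⟩
    two * q Q i 1ℚ + central (suc i) * (1ℚ * (1ℚ - two * 1ℚ)) + central (suc i)
      ≡⟨ cong (λ s → two * q Q i 1ℚ + central (suc i) * (s * (1ℚ - two * 1ℚ)) + central (suc i)) (sym (1^n≡1 (suc i))) ⟩
    two * q Q i 1ℚ + central (suc i) * (1ℚ ^ suc i * (1ℚ - two * 1ℚ)) + central (suc i)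
      ≡⟨ cong (_+ central (suc i)) (sym (q-step i 1ℚ)) ⟩
    two * (1ℚ - 1ℚ) * q Q (suc i) 1ℚ + central (suc i)
      ≡⟨ vanish (q Q (suc i) 1ℚ) (central (suc i)) ⟩
    central (suc i) ∎
    where
    open ≡-Reasoning
    expand : ∀ a c → two * a ≡ two * a + c * (1ℚ * (1ℚ - two * 1ℚ)) + c
    expand = solve-∀ ℚ-ring
    vanish : ∀ a c → two * (1ℚ - 1ℚ) * a + c ≡ c
    vanish = solve-∀ ℚ-ring

  V-at-one : ∀ i (x≢0 : 1ℚ ≢ 0ℚ) (h : 1ℚ - two * 1ℚ ≢ 0ℚ) → (ℕtoℚ (suc (suc i)) + 1ℚ) * V Q (suc i) 1ℚ x≢0 h ≡ central (suc (suc i))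
  V-at-one i x≢0 h = value-at-one {ℕtoℚ (suc i)} {ℕtoℚ (suc (suc i))} {central (suc i)} {central (suc (suc i))} {central (suc (suc (suc i)))}
                                  {q Q i 1ℚ} {q Q (suc i) 1ℚ} {q Q (suc (suc i)) 1ℚ} {V Q (suc i) 1ℚ x≢0 h}
                                  (ℕtoℚ-suc (suc i)) (central≢0 (suc i)) spec
                                  (q-at-one i) (q-at-one (suc i)) (q-at-one (suc (suc i)))
                                  (central-step (suc i)) (central-step (suc (suc i)))
    where
    spec : central (suc i) * (V Q (suc i) 1ℚ x≢0 h * (- 1ℚ)) ≡ two * (ℕtoℚ (suc i) + 1ℚ) * turán Q i 1ℚ
    spec = trans (cong (λ s → central (suc i) * (V Q (suc i) 1ℚ x≢0 h * (s * (1ℚ - two * 1ℚ)))) (sym (1^n≡1 (suc i))))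
                 (V-spec Q i 1ℚ x≢0 h)

  V₁≡2 : (x : ℚ) (x≢0 : x ≢ 0ℚ) (h : 1ℚ - two * x ≢ 0ℚ) → V Q 1 x x≢0 h ≡ two
  V₁≡2 x x≢0 h = cancel-factor {central 1} {V Q 1 x x≢0 h} {x ^ 1 * (1ℚ - two * x)} {two * (ℕtoℚ 1 + 1ℚ) * turán Q 0 x} {two}
    (*-≢0 (central≢0 1) (*-≢0 (^-≢0 1 x≢0) h)) (V-spec Q 0 x x≢0 h) (begin
    two * (1ℚ + 1ℚ) * turán Q 0 x                         ≡⟨ cong (two * (1ℚ + 1ℚ) *_) (turán-explicit 0 x) ⟩
    two * (1ℚ + 1ℚ) * ((1ℚ + x * (two + x * 0ℚ)) * (1ℚ + x * (two + x * 0ℚ))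
                       - (1ℚ + x * 0ℚ) * (1ℚ + x * (ℕtoℚ 3 + x * (ℕtoℚ 6 + x * 0ℚ))))
                                                          ≡⟨ solve (x ∷ []) ℚ-ring ⟩
    two * (x * 1ℚ * (1ℚ - two * x)) * two                 ∎)
    where open ≡-Reasoning

  V₂≡2x+3 : (x : ℚ) (x≢0 : x ≢ 0ℚ) (h : 1ℚ - two * x ≢ 0ℚ) → V Q 2 x x≢0 h ≡ two * x + ℕtoℚ 3
  V₂≡2x+3 x x≢0 h = cancel-factor {central 2} {V Q 2 x x≢0 h} {x ^ 2 * (1ℚ - two * x)} {two * (ℕtoℚ 2 + 1ℚ) * turán Q 1 x} {two * x + ℕtoℚ 3}
    (*-≢0 (central≢0 2) (*-≢0 (^-≢0 2 x≢0) h)) (V-spec Q 1 x x≢0 h) (begin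
    two * (two + 1ℚ) * turán Q 1 x                        ≡⟨ cong (two * (two + 1ℚ) *_) (turán-explicit 1 x) ⟩
    two * (two + 1ℚ) * ((1ℚ + x * (ℕtoℚ 3 + x * (ℕtoℚ 6 + x * 0ℚ))) * (1ℚ + x * (ℕtoℚ 3 + x * (ℕtoℚ 6 + x * 0ℚ)))
                        - (1ℚ + x * (two + x * 0ℚ)) * (1ℚ + x * (ℕtoℚ 4 + x * (ℕtoℚ 10 + x * (ℕtoℚ 20 + x * 0ℚ)))))
                                                          ≡⟨ solve (x ∷ []) ℚ-ring ⟩
    ℕtoℚ 6 * (x * (x * 1ℚ) * (1ℚ - two * x)) * (two * x + ℕtoℚ 3) ∎)
    where open ≡-Reasoning

  Recurrence : ℕ → (x : ℚ) → x ≢ 0ℚ → 1ℚ - two * x ≢ 0ℚ → Set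
  Recurrence n x x≢0 h =
    ℕtoℚ n * (x - 1ℚ) * V Q n x x≢0 h
      ≡ (two * ℕtoℚ (2 ℕ.* n ∸ 3) * x * (x - 1ℚ) - ℕtoℚ n - 1ℚ) * V Q (n ∸ 1) x x≢0 h
        + two * ℕtoℚ (2 ℕ.* n ∸ 1) * x * V Q (n ∸ 2) x x≢0 h

  V-recurrence-off-one : ∀ m x (x≢0 : x ≢ 0ℚ) (h : 1ℚ - two * x ≢ 0ℚ) → x ≢ 1ℚ → Recurrence (3 ℕ.+ m) x x≢0 h
  V-recurrence-off-one m x x≢0 h x≢1 =
    recurrence-off-one {x} {ℕtoℚ (1 ℕ.+ m)} {ℕtoℚ (2 ℕ.+ m)} {ℕtoℚ (3 ℕ.+ m)} {ℕtoℚ (2 ℕ.* (3 ℕ.+ m) ∸ 3)} {ℕtoℚ (2 ℕ.* (3 ℕ.+ m) ∸ 1)}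
                       {q Q m x} {q Q (1 ℕ.+ m) x} {q Q (2 ℕ.+ m) x} {q Q (3 ℕ.+ m) x}
                       {V Q (1 ℕ.+ m) x x≢0 h} {V Q (2 ℕ.+ m) x x≢0 h} {V Q (3 ℕ.+ m) x x≢0 h}
      (ℕtoℚ-suc (1 ℕ.+ m)) (ℕtoℚ-suc (2 ℕ.+ m)) (ℕtoℚ-2[3+m]∸3 m) (ℕtoℚ-2[3+m]∸1 m) (x≢1 ∘ sym ∘ p-q≡0⇒p≡q)
      (V-closed-form m x x≢0 h) (V-closed-form (1 ℕ.+ m) x x≢0 h) (V-closed-form (2 ℕ.+ m) x x≢0 h)
      (q-three-term m x) (q-three-term (1 ℕ.+ m) x)

  V-recurrence-at-one : ∀ m (x≢0 : 1ℚ ≢ 0ℚ) (h : 1ℚ - two * 1ℚ ≢ 0ℚ) → Recurrence (3 ℕ.+ m) 1ℚ x≢0 h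
  V-recurrence-at-one m x≢0 h =
    recurrence-at-one {ℕtoℚ (1 ℕ.+ m)} {ℕtoℚ (2 ℕ.+ m)} {ℕtoℚ (3 ℕ.+ m)} {ℕtoℚ (2 ℕ.* (3 ℕ.+ m) ∸ 3)} {ℕtoℚ (2 ℕ.* (3 ℕ.+ m) ∸ 1)}
                      {central (2 ℕ.+ m)} {central (3 ℕ.+ m)}
                      {V Q (1 ℕ.+ m) 1ℚ x≢0 h} {V Q (2 ℕ.+ m) 1ℚ x≢0 h} {V Q (3 ℕ.+ m) 1ℚ x≢0 h}
      (ℕtoℚ-suc (1 ℕ.+ m)) (ℕtoℚ-suc (2 ℕ.+ m)) (ℕtoℚ-2[3+m]∸3 m) (ℕtoℚ-2[3+m]∸1 m) (ℕtoℚ-suc≢0 (2 ℕ.+ m))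
      (V-at-one m x≢0 h) (V-at-one (suc m) x≢0 h) (central-step (2 ℕ.+ m))

  -- The closed form of V_n carries the factor 1 - x, so at x = 1 the explicit values are used instead.
  recurrence-by-cases : ∀ m x (x≢0 : x ≢ 0ℚ) (h : 1ℚ - two * x ≢ 0ℚ) → Dec (x ≡ 1ℚ) → Recurrence (3 ℕ.+ m) x x≢0 h
  recurrence-by-cases m .1ℚ x≢0 h (yes refl) = V-recurrence-at-one m x≢0 h
  recurrence-by-cases m x   x≢0 h (no x≢1)   = V-recurrence-off-one m x x≢0 h x≢1

  V-recurrence : (n : ℕ) → 3 ≤ n → (x : ℚ) (x≢0 : x ≢ 0ℚ) (h : 1ℚ - two * x ≢ 0ℚ) → Recurrence n x x≢0 h
  V-recurrence (suc (suc (suc m))) (s≤s (s≤s (s≤s z≤n))) x x≢0 h = recurrence-by-cases m x x≢0 h (x ℚₚ.≟ 1ℚ)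

proposition7p1 : (P Q : (m : ℕ) → Poly≤ m) → IsBezoutFamily P Q →
    ((x : ℚ) (x≢0 : x ≢ 0ℚ) (h : 1ℚ - two * x ≢ 0ℚ) → V Q 1 x x≢0 h ≡ two)
    × ((x : ℚ) (x≢0 : x ≢ 0ℚ) (h : 1ℚ - two * x ≢ 0ℚ) → V Q 2 x x≢0 h ≡ two * x + ℕtoℚ 3)
    × ((n : ℕ) → 3 ≤ n → (x : ℚ) (x≢0 : x ≢ 0ℚ) (h : 1ℚ - two * x ≢ 0ℚ) →
        ℕtoℚ n * (x - 1ℚ) * V Q n x x≢0 h
          ≡ (two * ℕtoℚ (2 Data.Nat.* n ∸ 3) * x * (x - 1ℚ) - ℕtoℚ n - 1ℚ) * V Q (n ∸ 1) x x≢0 h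
            + two * ℕtoℚ (2 Data.Nat.* n ∸ 1) * x * V Q (n ∸ 2) x x≢0 h)
proposition7p1 P Q bezout = V₁≡2 {P} {Q} bezout , V₂≡2x+3 {P} {Q} bezout , V-recurrence {P} {Q} bezout
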